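{- Let $G$ be a simple undirected graph with $n$ vertices ($n\in\mathbb{N}$). Then $G$ is acyclic if and only if every coding sequence $\beta(G,n)$ of $G$ is linearly independent over $\mathbb{Z}_2$.
   Context: Coding sequences: for a simple graph $G=(V,E)$ with $n$ vertices, choose a labeling $V=\{v_0,\ldots,v_{n-1}\}$. For an edge $e=v_iv_j$ with $i>j$ let $f^\#(e)=(x_1,\ldots,x_{n-1})\in\mathbb{Z}_2^{n-1}$ with $x_k=1$ iff $n-i\le k\le n-j-1$ and $x_k=0$ otherwise. The coding sequence $\beta(G,n)$ for that labeling is the set $\{f^\#(e):e\in E\}$ (empty if $E=\emptyset$; the empty set counts as linearly independent). -}

module Defs where

open import Data.Nat using (ℕ; suc; _∸_; _≤_; _<_; _≤ᵇ_)
open import Data.Fin using (Fin; toℕ)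
open import Data.Bool using (Bool; false; _∧_; _xor_)
open import Data.List using (List; []; _∷_; _++_; [_]; length; foldr)
open import Data.List.Relation.Unary.All using (All)
open import Data.List.Relation.Unary.Linked using (Linked)
open import Data.List.Relation.Unary.Unique.Propositional using (Unique)
open import Data.Vec using (Vec; tabulate; zipWith; replicate)
open import Data.Product using (Σ; ∃; ∃-syntax; _×_)
open import Relation.Nullary using (¬_)
open import Relation.Binary.PropositionalEquality using (_≡_)
open import Function.Bundles using (_↔_; Inverse)

record SimpleGraph (n : ℕ) : Set₁ where
  field
    Adj   : Fin n → Fin n → Set
    sym   : ∀ {u v} → Adj u v → Adj v u
    irrefl : ∀ {v} → ¬ Adj v v
open SimpleGraph public

IsCycle : ∀ {n} → SimpleGraph n → List (Fin n) → Set
IsCycle G vs =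
  3 ≤ length vs × Unique vs ×
  ∃[ v ] ∃[ ws ] (vs ≡ v ∷ ws × Linked (Adj G) (v ∷ ws ++ [ v ]))

Acyclic : ∀ {n} → SimpleGraph n → Set
Acyclic G = ¬ (∃[ vs ] IsCycle G vs)

-- A labeling V = {v₀,…,v_{n-1}}: a bijection i ↦ v_i from Fin n onto the vertices.
Labeling : ℕ → Set
Labeling n = Fin n ↔ Fin n

-- f#(v_i v_j) for i > j : the vector (x₁,…,x_{n-1}) ∈ ℤ₂^{n-1}
-- with x_k = 1 iff n - i ≤ k ≤ n - j - 1.
-- Coordinate index c : Fin (n ∸ 1) stands for k = c + 1.
fsharp : (n : ℕ) → Fin n → Fin n → Vec Bool (n ∸ 1)
fsharp n i j = tabulate λ c →
  (n ∸ toℕ i ≤ᵇ suc (toℕ c)) ∧ (suc (toℕ c) ≤ᵇ n ∸ toℕ j ∸ 1)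

β : ∀ {n} → SimpleGraph n → Labeling n → Vec Bool (n ∸ 1) → Set
β {n} G σ x =
  ∃[ i ] ∃[ j ] (toℕ j < toℕ i × Adj G (Inverse.to σ i) (Inverse.to σ j) × x ≡ fsharp n i j)

sumℤ₂ : ∀ {m} → List (Vec Bool m) → Vec Bool m
sumℤ₂ {m} = foldr (zipWith _xor_) (replicate m false)

-- A set S ⊆ ℤ₂^m is linearly independent over ℤ₂: no nonempty finite set
-- of distinct elements of S sums to zero (over ℤ₂ the only nonzero coefficient is 1).
LinIndep : ∀ {m} → (Vec Bool m → Set) → Set
LinIndep {m} S =
  ∀ (xs : List (Vec Bool m)) → Unique xs → All S xs → sumℤ₂ xs ≡ replicate m false → xs ≡ []

module Submission where

-- The coding vector f#(v_i v_j) (j < i) is the indicator of an interval of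
-- coordinates.  The discrete derivative ("boundary") ∂x_w = x_{p+1} + x_p, taken at the
-- position p = n - 1 - w of vertex w (with x_0 = x_n = 0), turns this interval into the
-- two endpoints {i, j} of the edge.  ∂ is linear and has trivial kernel, so a set of
-- coding vectors sums to zero iff in the corresponding set of edges every vertex has
-- even degree.  Hence, for every labeling σ,
--   β(G,n) independent  ⇔  the relabelled graph has no nonempty even edge set   (coding)
-- and the theorem follows from the purely graph-theoretic fact
--   G acyclic  ⇔  G has no nonempty even edge set,                           (evenness)
-- together with invariance of acyclicity under relabelling.  For (evenness): the edges
-- of a cycle form an even edge set, since the degree parities along a closed walk
-- telescope.  Conversely, starting from an edge of an even edge set, grow a simple path
-- edge by edge: even degree at its newest vertex always supplies another edge of the
-- set, and as a simple path has at most n vertices, some such edge eventually leads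
-- back onto the path and closes a cycle.

open import Defs hiding (sym)
open import Data.Nat using (ℕ; zero; suc; _+_; _∸_; _≤_; _<_; _≤ᵇ_; z≤n; s≤s)
import Data.Nat.Properties as ℕ
open import Data.Fin as Fin using (Fin; toℕ)
open import Data.Fin.Properties using (toℕ<n; toℕ-injective; toℕ-fromℕ<; pigeonhole)
open import Data.Bool using (Bool; true; false; _∧_; _xor_)
open import Data.Bool.Properties
  using (xor-assoc; xor-comm; xor-same; xor-identityʳ; ∧-zeroʳ; xor-∧-commutativeRing)
open import Data.Vec using (Vec; []; _∷_; tabulate; zipWith; replicate)
open import Data.List as List using (List; []; _∷_; _++_; [_]; length; foldr; map)
open import Data.List.Properties using (length-map; map-++)
open import Data.List.Relation.Unary.All as All using (All; []; _∷_)
open import Data.List.Relation.Unary.All.Properties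
  using (anti-mono; ¬Any⇒All¬) renaming (map⁺ to All-map⁺)
open import Data.List.Relation.Unary.Any using (here; there; any?)
open import Data.List.Relation.Unary.AllPairs using ([]; _∷_)
open import Data.List.Relation.Unary.Linked using (Linked; []; [-]; _∷_)
import Data.List.Relation.Unary.Linked.Properties as Linked
open import Data.List.Relation.Unary.Unique.Propositional using (Unique)
import Data.List.Relation.Unary.Unique.Propositional.Properties as Unique
open import Data.List.Membership.Propositional using (_∈_)
open import Data.List.Membership.Propositional.Properties using (∈-lookup; ∈-++⁻)
open import Data.List.Relation.Binary.Subset.Propositional using (_⊆_)
open import Data.List.Relation.Binary.Subset.Propositional.Properties using (∷⁺ʳ)
open import Data.Product using (∃; ∃-syntax; _×_; _,_; proj₁; proj₂)
open import Data.Sum using (_⊎_; inj₁; inj₂)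
open import Data.Empty using (⊥-elim)
open import Relation.Nullary using (¬_; yes; no; does)
open import Relation.Nullary.Decidable using (dec-true; dec-false; does-⇔)
open import Function.Bundles using (_⇔_; Inverse; Injection; Equivalence; mk⇔)
open import Function.Properties.Inverse using (↔⇒↣)
open import Function.Construct.Identity using (↔-id)
open import Relation.Binary.PropositionalEquality hiding ([_])
open ≡-Reasoning

open import Algebra.Bundles using (CommutativeRing)
open import Algebra.Properties.CommutativeSemigroup
  (CommutativeRing.+-commutativeSemigroup xor-∧-commutativeRing) using (interchange)

xor-telescope : ∀ a b c → (a xor b) xor (b xor c) ≡ a xor c
xor-telescope a b c = begin
  (a xor b) xor (b xor c)  ≡⟨ xor-assoc a b (b xor c) ⟩
  a xor (b xor (b xor c))  ≡⟨ cong (a xor_) (sym (xor-assoc b b c)) ⟩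
  a xor ((b xor b) xor c)  ≡⟨ cong (λ x → a xor (x xor c)) (xor-same b) ⟩
  a xor c                  ∎

xor-zeroˡ : ∀ {a b} → a xor b ≡ false → b ≡ false → a ≡ false
xor-zeroˡ {a} sum refl = trans (sym (xor-identityʳ a)) sum

true-xor-zero : ∀ {b} → true xor b ≡ false → b ≡ true
true-xor-zero {true} _ = refl

-- The m-th entry of a vector (counting from 0), read as 0 beyond its length.
entry : ∀ {k} → Vec Bool k → ℕ → Bool
entry [] m = false
entry (b ∷ x) zero = b
entry (b ∷ x) (suc m) = entry x m

-- The paper's coordinate x_m (counting from 1), extended by x_0 = 0 and x_m = 0 for m > k.
coord : ∀ {k} → Vec Bool k → ℕ → Bool
coord x zero = false
coord x (suc m) = entry x m

entry-⊕ : ∀ {k} (x y : Vec Bool k) m → entry (zipWith _xor_ x y) m ≡ entry x m xor entry y m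
entry-⊕ [] [] m = refl
entry-⊕ (a ∷ x) (b ∷ y) zero = refl
entry-⊕ (a ∷ x) (b ∷ y) (suc m) = entry-⊕ x y m

coord-⊕ : ∀ {k} (x y : Vec Bool k) m → coord (zipWith _xor_ x y) m ≡ coord x m xor coord y m
coord-⊕ x y zero = refl
coord-⊕ x y (suc m) = entry-⊕ x y m

entry-zero : ∀ k m → entry (replicate k false) m ≡ false
entry-zero zero m = refl
entry-zero (suc k) zero = refl
entry-zero (suc k) (suc m) = entry-zero k m

coord-zero : ∀ k m → coord (replicate k false) m ≡ false
coord-zero k zero = refl
coord-zero k (suc m) = entry-zero k m

entry-tabulate : ∀ {k} (f : ℕ → Bool) → (∀ m → k ≤ m → f m ≡ false) →
                 ∀ m → entry (tabulate {n = k} (λ c → f (toℕ c))) m ≡ f m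
entry-tabulate {zero} f outside m = sym (outside m z≤n)
entry-tabulate {suc k} f outside zero = refl
entry-tabulate {suc k} f outside (suc m) =
  entry-tabulate (λ m → f (suc m)) (λ m k≤m → outside (suc m) (s≤s k≤m)) m

entries-vanish : ∀ {k} (x : Vec Bool k) → (∀ m → m < k → entry x m ≡ false) → x ≡ replicate k false
entries-vanish [] _ = refl
entries-vanish (b ∷ x) vanish =
  cong₂ _∷_ (vanish zero (s≤s z≤n)) (entries-vanish x (λ m m<k → vanish (suc m) (s≤s m<k)))

-- Indicator of the interval [a, b] of ℕ; this is exactly the pattern used by fsharp.
interval : ℕ → ℕ → ℕ → Bool
interval a b m = (a ≤ᵇ m) ∧ (m ≤ᵇ b)

≤ᵇ-suc : ∀ m n → (suc m ≤ᵇ suc n) ≡ (m ≤ᵇ n)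
≤ᵇ-suc zero n = refl
≤ᵇ-suc (suc m) n = refl

interval-suc : ∀ a b m → interval (suc a) (suc b) (suc m) ≡ interval a b m
interval-suc a b m = cong₂ _∧_ (≤ᵇ-suc a m) (≤ᵇ-suc m b)

interval-above : ∀ a {b m} → b < m → interval a b m ≡ false
interval-above a {b} {m} b<m =
  trans (cong ((a ≤ᵇ m) ∧_) (dec-false (m ℕ.≤? b) (ℕ.<⇒≱ b<m))) (∧-zeroʳ _)

initial-step : ∀ b t → (suc t ≤ᵇ b) xor (t ≤ᵇ b) ≡ does (b ℕ.≟ t)
initial-step zero zero = refl
initial-step zero (suc t) = refl
initial-step (suc b) zero = refl
initial-step (suc b) (suc t) = trans (cong₂ _xor_ (≤ᵇ-suc (suc t) b) (≤ᵇ-suc t b)) (initial-step b t)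

interval-step : ∀ a b t → a ≤ b →
  interval a b (suc t) xor interval a b t ≡ does (a ℕ.≟ suc t) xor does (b ℕ.≟ t)
interval-step zero b t _ = initial-step b t
interval-step (suc zero) (suc b) zero _ = refl
interval-step (suc (suc a)) (suc b) zero _ = refl
interval-step (suc a) (suc b) (suc t) (s≤s a≤b) =
  trans (cong₂ _xor_ (interval-suc a b (suc t)) (interval-suc a b t)) (interval-step a b t a≤b)

coord-interval : ∀ {k} a b → b ≤ k → ∀ m →
  coord (tabulate {n = k} (λ c → interval (suc a) b (suc (toℕ c)))) m ≡ interval (suc a) b m
coord-interval a b b≤k zero = refl
coord-interval a b b≤k (suc m) =
  entry-tabulate (λ m → interval (suc a) b (suc m))
    (λ m k≤m → interval-above (suc a) (s≤s (ℕ.≤-trans b≤k k≤m))) m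

-- A potential edge on the vertex set Fin n, as a pair (i , j); it is ordered when j < i,
-- the form in which the paper's f# receives it.
Edge : ℕ → Set
Edge n = Fin n × Fin n

Ordered : ∀ {n} → Edge n → Set
Ordered e = toℕ (proj₂ e) < toℕ (proj₁ e)

code : ∀ {n} → Edge n → Vec Bool (n ∸ 1)
code {n} (i , j) = fsharp n i j

incident : ∀ {n} → Fin n → Edge n → Bool
incident w (i , j) = does (w Fin.≟ i) xor does (w Fin.≟ j)

degreeParity : ∀ {n} → Fin n → List (Edge n) → Bool
degreeParity w = foldr (λ e p → incident w e xor p) false

Joins : ∀ {n} → Fin n → Edge n → Fin n → Set
Joins w e u = e ≡ (w , u) ⊎ e ≡ (u , w)

module _ {n : ℕ} where

  ordered⇒distinct : ∀ {i j : Fin n} → Ordered (i , j) → i ≢ j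
  ordered⇒distinct j<i refl = ℕ.<-irrefl refl j<i

  incident-endpoints : ∀ {i j : Fin n} → Ordered (i , j) →
                       incident i (i , j) ≡ true × incident j (i , j) ≡ true
  incident-endpoints {i} {j} j<i =
      cong₂ _xor_ (dec-true (i Fin.≟ i) refl) (dec-false (i Fin.≟ j) i≢j)
    , cong₂ _xor_ (dec-false (j Fin.≟ i) (λ j≡i → i≢j (sym j≡i))) (dec-true (j Fin.≟ j) refl)
    where i≢j = ordered⇒distinct j<i

  incident⇒endpoint : ∀ {w i j : Fin n} → incident w (i , j) ≡ true → w ≡ i ⊎ w ≡ j
  incident⇒endpoint {w} {i} {j} inc with w Fin.≟ i | w Fin.≟ j
  ... | yes w≡i | _ = inj₁ w≡i
  ... | no _ | yes w≡j = inj₂ w≡j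
  incident⇒endpoint () | no _ | no _

  incident⇒joins : ∀ {w : Fin n} e → incident w e ≡ true → ∃[ u ] Joins w e u
  incident⇒joins {w} (i , j) inc with incident⇒endpoint {w} {i} {j} inc
  ... | inj₁ refl = j , inj₁ refl
  ... | inj₂ refl = i , inj₂ refl

  joins⇒incident : ∀ {w u : Fin n} {e} → Ordered e → Joins w e u → incident w e ≡ true
  joins⇒incident ord (inj₁ refl) = proj₁ (incident-endpoints ord)
  joins⇒incident ord (inj₂ refl) = proj₂ (incident-endpoints ord)

  joins-sym : ∀ {w u : Fin n} {e} → Joins w e u → Joins u e w
  joins-sym (inj₁ e≡wu) = inj₂ e≡wu
  joins-sym (inj₂ e≡uw) = inj₁ e≡uw

  joins-endpoint : ∀ {a b w u : Fin n} {e} → Joins a e b → Joins w e u → w ≡ a ⊎ w ≡ b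
  joins-endpoint (inj₁ refl) (inj₁ refl) = inj₁ refl
  joins-endpoint (inj₁ refl) (inj₂ refl) = inj₂ refl
  joins-endpoint (inj₂ refl) (inj₁ refl) = inj₂ refl
  joins-endpoint (inj₂ refl) (inj₂ refl) = inj₁ refl

  joins-unique : ∀ {w u : Fin n} {e e′} → Ordered e → Ordered e′ → Joins w e u → Joins w e′ u → e ≡ e′
  joins-unique _ _ (inj₁ refl) (inj₁ refl) = refl
  joins-unique _ _ (inj₂ refl) (inj₂ refl) = refl
  joins-unique ord ord′ (inj₁ refl) (inj₂ refl) = ⊥-elim (ℕ.<-asym ord ord′)
  joins-unique ord ord′ (inj₂ refl) (inj₁ refl) = ⊥-elim (ℕ.<-asym ord ord′)

  incidence-determines-edge : ∀ {e e′ : Edge n} → Ordered e → Ordered e′ →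
    (∀ w → incident w e ≡ incident w e′) → e ≡ e′
  incidence-determines-edge {i , j} {i′ , j′} ord ord′ same
    with incident⇒endpoint {i} {i′} {j′} (trans (sym (same i)) (proj₁ (incident-endpoints ord)))
       | incident⇒endpoint {j} {i′} {j′} (trans (sym (same j)) (proj₂ (incident-endpoints ord)))
  ... | inj₁ refl | inj₂ refl = refl
  ... | inj₁ refl | inj₁ refl = ⊥-elim (ordered⇒distinct ord refl)
  ... | inj₂ refl | inj₂ refl = ⊥-elim (ordered⇒distinct ord refl)
  ... | inj₂ refl | inj₁ refl = ⊥-elim (ℕ.<-asym ord ord′)

  odd⇒incident : ∀ (w : Fin n) E → degreeParity w E ≡ true → ∃[ e ] (e ∈ E × incident w e ≡ true)
  odd⇒incident w (e ∷ E) odd with incident w e in inc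
  ... | true = e , here refl , inc
  ... | false with odd⇒incident w E odd
  ...   | e′ , e′∈E , inc′ = e′ , there e′∈E , inc′

  partner-edge : ∀ (w : Fin n) {e₀} E → degreeParity w E ≡ false → Unique E → e₀ ∈ E →
    incident w e₀ ≡ true → ∃[ e ] (e ∈ E × incident w e ≡ true × e ≢ e₀)
  partner-edge w (e ∷ E) even (e∉E ∷ distinct) (here refl) inc₀
    with odd⇒incident w E (true-xor-zero (subst (λ b → b xor degreeParity w E ≡ false) inc₀ even))
  ... | e′ , e′∈E , inc′ = e′ , there e′∈E , inc′ , λ e′≡e → All.lookup e∉E e′∈E (sym e′≡e)
  partner-edge w (e ∷ E) even (e∉E ∷ distinct) (there e₀∈E) inc₀ with incident w e in inc
  ... | true = e , here refl , inc , All.lookup e∉E e₀∈E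
  ... | false with partner-edge w E even distinct e₀∈E inc₀
  ...   | e′ , e′∈E , inc′ , e′≢e₀ = e′ , there e′∈E , inc′ , e′≢e₀

module _ {n : ℕ} where

  -- Vertex w sits between the coordinates pos w and pos w + 1, where pos w = n - 1 - w.
  pos : Fin n → ℕ
  pos w = n ∸ suc (toℕ w)

  pos-injective : ∀ {v w : Fin n} → pos v ≡ pos w → v ≡ w
  pos-injective {v} {w} eq = toℕ-injective (ℕ.suc-injective (ℕ.∸-cancelˡ-≡ (toℕ<n v) (toℕ<n w) eq))

  pos-reverses : ∀ {i j : Fin n} → toℕ j < toℕ i → pos i < pos j
  pos-reverses {i} j<i = ℕ.∸-monoʳ-< (s≤s j<i) (toℕ<n i)

  vertex-at : ∀ m → m < n → ∃[ w ] pos w ≡ m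
  vertex-at m m<n = w , ℕ.suc-injective (begin
      suc (pos w)          ≡⟨ sym (ℕ.+-∸-assoc 1 (toℕ<n w)) ⟩
      n ∸ toℕ w            ≡⟨ cong (n ∸_) (toℕ-fromℕ< below) ⟩
      n ∸ (n ∸ suc m)      ≡⟨ ℕ.m∸[m∸n]≡n m<n ⟩
      suc m                ∎)
    where
    below : n ∸ suc m < n
    below = ℕ.∸-monoʳ-< (s≤s z≤n) m<n
    w = Fin.fromℕ< below

  ∂ : Vec Bool (n ∸ 1) → Fin n → Bool
  ∂ x w = coord x (suc (pos w)) xor coord x (pos w)

  ∂-⊕ : ∀ x y w → ∂ (zipWith _xor_ x y) w ≡ ∂ x w xor ∂ y w
  ∂-⊕ x y w = trans (cong₂ _xor_ (coord-⊕ x y (suc p)) (coord-⊕ x y p))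
                    (interchange (coord x (suc p)) (coord y (suc p)) (coord x p) (coord y p))
    where p = pos w

  ∂-zero : ∀ w → ∂ (replicate (n ∸ 1) false) w ≡ false
  ∂-zero w = cong₂ _xor_ (coord-zero (n ∸ 1) (suc (pos w))) (coord-zero (n ∸ 1) (pos w))

  -- ∂ has trivial kernel: the coordinates x_1, x_2, … vanish one after the other.
  ∂-kernel : ∀ x → (∀ w → ∂ x w ≡ false) → x ≡ replicate (n ∸ 1) false
  ∂-kernel x ∂x≡0 =
    entries-vanish x (λ m m<n∸1 → coord-vanishes (suc m) (ℕ.<-≤-trans m<n∸1 (ℕ.m∸n≤m n 1)))
    where
    coord-vanishes : ∀ m → m ≤ n → coord x m ≡ false
    coord-vanishes zero _ = refl
    coord-vanishes (suc m) m<n with vertex-at m m<n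
    ... | w , pos-w≡m = xor-zeroˡ (subst (λ p → coord x (suc p) xor coord x p ≡ false) pos-w≡m (∂x≡0 w))
                                  (coord-vanishes m (ℕ.<⇒≤ m<n))

  code-interval : ∀ i j m → coord (code (i , j)) m ≡ interval (suc (pos i)) (pos j) m
  code-interval i j m = begin
    coord (code (i , j)) m
      ≡⟨ cong (λ x → coord x m) code≡ ⟩
    coord (tabulate (λ c → interval (suc (pos i)) (pos j) (suc (toℕ c)))) m
      ≡⟨ coord-interval (pos i) (pos j) pos≤ m ⟩
    interval (suc (pos i)) (pos j) m
      ∎
    where
    lower : ∀ v → n ∸ toℕ v ≡ suc (pos v)
    lower v = ℕ.+-∸-assoc 1 (toℕ<n v)
    code≡ : code (i , j) ≡ tabulate (λ c → interval (suc (pos i)) (pos j) (suc (toℕ c)))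
    code≡ = cong₂ (λ a b → tabulate (λ c → interval a b (suc (toℕ c)))) (lower i) (cong (_∸ 1) (lower j))
    pos≤ : pos j ≤ n ∸ 1
    pos≤ = ℕ.∸-monoʳ-≤ n (s≤s z≤n)

  ∂-code : ∀ {e : Edge n} → Ordered e → ∀ w → ∂ (code e) w ≡ incident w e
  ∂-code {i , j} j<i w = begin
    coord (code (i , j)) (suc (pos w)) xor coord (code (i , j)) (pos w)
      ≡⟨ cong₂ _xor_ (code-interval i j (suc (pos w))) (code-interval i j (pos w)) ⟩
    interval (suc (pos i)) (pos j) (suc (pos w)) xor interval (suc (pos i)) (pos j) (pos w)
      ≡⟨ interval-step (suc (pos i)) (pos j) (pos w) (pos-reverses j<i) ⟩
    does (pos i ℕ.≟ pos w) xor does (pos j ℕ.≟ pos w)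
      ≡⟨ cong₂ _xor_ (same-position i) (same-position j) ⟩
    does (w Fin.≟ i) xor does (w Fin.≟ j)
      ∎
    where
    same-position : ∀ v → does (pos v ℕ.≟ pos w) ≡ does (w Fin.≟ v)
    same-position v = does-⇔ (mk⇔ (λ eq → sym (pos-injective eq)) (λ eq → cong pos (sym eq)))
                                  (pos v ℕ.≟ pos w) (w Fin.≟ v)

  ∂-sum-codes : ∀ {E : List (Edge n)} → All Ordered E → ∀ w →
                ∂ (sumℤ₂ (map code E)) w ≡ degreeParity w E
  ∂-sum-codes [] w = ∂-zero w
  ∂-sum-codes {e ∷ E} (ord ∷ ords) w =
    trans (∂-⊕ (code e) (sumℤ₂ (map code E)) w) (cong₂ _xor_ (∂-code ord w) (∂-sum-codes ords w))

  sum-codes-zero⇔even : ∀ {E : List (Edge n)} → All Ordered E →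
    sumℤ₂ (map code E) ≡ replicate (n ∸ 1) false ⇔ (∀ w → degreeParity w E ≡ false)
  sum-codes-zero⇔even ords = mk⇔
    (λ sum≡0 w → trans (sym (∂-sum-codes ords w)) (trans (cong (λ x → ∂ x w) sum≡0) (∂-zero w)))
    (λ even → ∂-kernel _ (λ w → trans (∂-sum-codes ords w) (even w)))

  code-injective : ∀ {e e′ : Edge n} → Ordered e → Ordered e′ → code e ≡ code e′ → e ≡ e′
  code-injective ord ord′ eq = incidence-determines-edge ord ord′
    (λ w → trans (sym (∂-code ord w)) (trans (cong (λ x → ∂ x w) eq) (∂-code ord′ w)))

  codes-distinct : ∀ {E : List (Edge n)} → All Ordered E → Unique E → Unique (map code E)
  codes-distinct [] [] = []
  codes-distinct (ord ∷ ords) (e∉ ∷ distinct) =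
    All-map⁺ (All.tabulate λ e′∈ eq → All.lookup e∉ e′∈ (code-injective ord (All.lookup ords e′∈) eq))
    ∷ codes-distinct ords distinct

unique-length≤ : ∀ {n} {xs : List (Fin n)} → Unique xs → length xs ≤ n
unique-length≤ {n} {xs} distinct with length xs ℕ.≤? n
... | yes le = le
... | no gt with pigeonhole (ℕ.≰⇒> gt) (List.lookup xs)
...   | i , j , i<j , same = ⊥-elim (lookup-distinct distinct i<j same)
  where
  lookup-distinct : ∀ {ys : List (Fin n)} {i j} → Unique ys → i Fin.< j →
                    List.lookup ys i ≢ List.lookup ys j
  lookup-distinct {y ∷ ys} {Fin.zero} {Fin.suc j} (y∉ys ∷ _) _ = All.lookup y∉ys (∈-lookup j)
  lookup-distinct {_ ∷ _} {Fin.suc i} {Fin.suc j} (_ ∷ distinct) (s≤s i<j) = lookup-distinct distinct i<j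

nonempty⇒member : ∀ {A : Set} {xs : List A} → xs ≢ [] → ∃[ x ] x ∈ xs
nonempty⇒member {xs = []} nonempty = ⊥-elim (nonempty refl)
nonempty⇒member {xs = x ∷ _} _ = x , here refl

unique-snoc : ∀ {A : Set} {xs : List A} {v} → Unique xs → All (v ≢_) xs → Unique (xs ++ [ v ])
unique-snoc distinct v∉xs = Unique.++⁺ distinct ([] ∷ [])
  (λ { (x∈xs , here refl) → All.lookup v∉xs x∈xs refl })

module _ {n : ℕ} where

  orient : Fin n → Fin n → Edge n
  orient a b with toℕ b ℕ.<? toℕ a
  ... | yes _ = (a , b)
  ... | no _ = (b , a)

  orient-joins : ∀ a b → Joins a (orient a b) b
  orient-joins a b with toℕ b ℕ.<? toℕ a
  ... | yes _ = inj₁ refl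
  ... | no _ = inj₂ refl

  orient-incident : ∀ w a b → incident w (orient a b) ≡ does (w Fin.≟ a) xor does (w Fin.≟ b)
  orient-incident w a b with toℕ b ℕ.<? toℕ a
  ... | yes _ = refl
  ... | no _ = xor-comm (does (w Fin.≟ b)) (does (w Fin.≟ a))

  walkEdges : List (Fin n) → List (Edge n)
  walkEdges (a ∷ b ∷ l) = orient a b ∷ walkEdges (b ∷ l)
  walkEdges _ = []

  -- Degree parities along a walk telescope: only the two ends can have odd degree.
  walk-parity : ∀ w a l z →
    degreeParity w (walkEdges (a ∷ l ++ [ z ])) ≡ does (w Fin.≟ a) xor does (w Fin.≟ z)
  walk-parity w a [] z = trans (xor-identityʳ _) (orient-incident w a z)
  walk-parity w a (b ∷ l) z = begin
    incident w (orient a b) xor degreeParity w (walkEdges (b ∷ l ++ [ z ]))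
      ≡⟨ cong₂ _xor_ (orient-incident w a b) (walk-parity w b l z) ⟩
    (does (w Fin.≟ a) xor does (w Fin.≟ b)) xor (does (w Fin.≟ b) xor does (w Fin.≟ z))
      ≡⟨ xor-telescope (does (w Fin.≟ a)) (does (w Fin.≟ b)) (does (w Fin.≟ z)) ⟩
    does (w Fin.≟ a) xor does (w Fin.≟ z)
      ∎

  walkEdges-vertices : ∀ {p e w u} → e ∈ walkEdges p → Joins w e u → w ∈ p
  walkEdges-vertices {a ∷ b ∷ l} (here refl) wu with joins-endpoint (orient-joins a b) wu
  ... | inj₁ w≡a = here w≡a
  ... | inj₂ w≡b = there (here w≡b)
  walkEdges-vertices {a ∷ b ∷ l} (there e∈) wu = there (walkEdges-vertices e∈ wu)

  path-edges-distinct : ∀ {p} → Unique p → Unique (walkEdges p)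
  path-edges-distinct {[]} _ = []
  path-edges-distinct {_ ∷ []} _ = []
  path-edges-distinct {a ∷ b ∷ l} (a∉ ∷ simple) =
    All.tabulate (λ e∈ ab≡e → All.lookup a∉ (walkEdges-vertices e∈ (joins-ab ab≡e)) refl)
    ∷ path-edges-distinct simple
    where
    joins-ab : ∀ {e} → orient a b ≡ e → Joins a e b
    joins-ab refl = orient-joins a b

  -- A cycle v w₁ w₂ … v traverses distinct edges: the closing path w₁ w₂ … v is simple,
  -- and its edges avoid v or w₁, so none of them joins v to w₁.
  cycle-edges-distinct : ∀ {v w₁ w₂ r} → Unique (v ∷ w₁ ∷ w₂ ∷ r) →
                         Unique (walkEdges (v ∷ w₁ ∷ w₂ ∷ r ++ [ v ]))
  cycle-edges-distinct {v} {w₁} {w₂} {r} (v∉ ∷ w₁∉ ∷ simple) =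
    (first-differs ∷ All.tabulate later-differs) ∷ path-edges-distinct (unique-snoc (w₁∉ ∷ simple) v∉)
    where
    vw₁ = orient-joins v w₁
    first-differs : orient v w₁ ≢ orient w₁ w₂
    first-differs eq with joins-endpoint (orient-joins w₁ w₂) (subst (λ e → Joins v e w₁) eq vw₁)
    ... | inj₁ v≡w₁ = All.lookup v∉ (here refl) v≡w₁
    ... | inj₂ v≡w₂ = All.lookup v∉ (there (here refl)) v≡w₂
    later-differs : ∀ {e} → e ∈ walkEdges (w₂ ∷ r ++ [ v ]) → orient v w₁ ≢ e
    later-differs e∈ refl with ∈-++⁻ (w₂ ∷ r) (walkEdges-vertices e∈ (joins-sym vw₁))
    ... | inj₁ w₁∈ = All.lookup w₁∉ w₁∈ refl
    ... | inj₂ (here w₁≡v) = All.lookup v∉ (here refl) (sym w₁≡v)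

module _ {n : ℕ} (G : SimpleGraph n) where

  IsEdge : Edge n → Set
  IsEdge e = Ordered e × Adj G (proj₁ e) (proj₂ e)

  record EvenEdgeSet : Set where
    field
      edges    : List (Edge n)
      nonempty : edges ≢ []
      areEdges : All IsEdge edges
      distinct : Unique edges
      even     : ∀ w → degreeParity w edges ≡ false

  adj⇒≢ : ∀ {u v} → Adj G u v → u ≢ v
  adj⇒≢ adj refl = irrefl G adj

  joins-adj : ∀ {w u e} → IsEdge e → Joins w e u → Adj G w u
  joins-adj (_ , adj) (inj₁ refl) = adj
  joins-adj (_ , adj) (inj₂ refl) = SimpleGraph.sym G adj

  path-to : ∀ {u v} x l → Linked (Adj G) (x ∷ l) → Unique (x ∷ l) → u ∈ l → Adj G u v →
    ∃[ q ] (1 ≤ length q × q ⊆ l × Unique (x ∷ q) × Linked (Adj G) (x ∷ q ++ [ v ]))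
  path-to x (y ∷ l) (x~y ∷ _) (x∉ ∷ _) (here refl) u~v =
    [ y ] , s≤s z≤n , (λ { (here refl) → here refl }) , (All.lookup x∉ (here refl) ∷ []) ∷ [] ∷ [] ,
    x~y ∷ u~v ∷ [-]
  path-to x (y ∷ l) (x~y ∷ path) (x∉ ∷ simple) (there u∈l) u~v with path-to y l path simple u∈l u~v
  ... | q , _ , q⊆l , simple′ , path′ =
    y ∷ q , s≤s z≤n , ∷⁺ʳ y q⊆l ,
    anti-mono (∷⁺ʳ y q⊆l) x∉ ∷ simple′ , x~y ∷ path′

  chord⇒cycle : ∀ {w₀ w₁ u rest} → Unique (w₀ ∷ w₁ ∷ rest) → Linked (Adj G) (w₀ ∷ w₁ ∷ rest) →
    u ∈ rest → Adj G u w₀ → ∃ (IsCycle G)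
  chord⇒cycle {w₀} {w₁} {rest = rest} (w₀∉ ∷ simple) (w₀~w₁ ∷ path) u∈rest u~w₀
    with path-to w₁ rest path simple u∈rest u~w₀
  ... | q , 1≤q , q⊆rest , simple′ , path′ =
    w₀ ∷ w₁ ∷ q , s≤s (s≤s 1≤q) , anti-mono (∷⁺ʳ w₁ q⊆rest) w₀∉ ∷ simple′ ,
    w₀ , w₁ ∷ q , refl , w₀~w₁ ∷ path′

  -- Walk along edges of the set, keeping a simple path w₀ w₁ … rest (newest vertex first)
  -- whose first edge e₀ belongs to the set.  Even degree at w₀ provides a second edge at
  -- w₀; its far end u differs from w₀ and w₁, and either lies on the path, closing a
  -- cycle, or extends the path.  A simple path has at most n vertices, which bounds the
  -- number of steps.
  module _ (S : EvenEdgeSet) where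
    open EvenEdgeSet S

    edge-at : ∀ {e} → e ∈ edges → IsEdge e
    edge-at = All.lookup areEdges

    walk : (fuel : ℕ) (w₀ w₁ : Fin n) (rest : List (Fin n)) {e₀ : Edge n} →
      n < length (w₀ ∷ w₁ ∷ rest) + fuel → e₀ ∈ edges → Joins w₀ e₀ w₁ →
      Unique (w₀ ∷ w₁ ∷ rest) → Linked (Adj G) (w₀ ∷ w₁ ∷ rest) → ∃ (IsCycle G)
    walk zero w₀ w₁ rest bound _ _ simple _ =
      ⊥-elim (ℕ.<⇒≱ (subst (n <_) (ℕ.+-identityʳ _) bound) (unique-length≤ simple))
    walk (suc fuel) w₀ w₁ rest {e₀} bound e₀∈E w₀e₀w₁ simple path
      with partner-edge w₀ edges (even w₀) distinct e₀∈E (joins⇒incident (proj₁ (edge-at e₀∈E)) w₀e₀w₁)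
    ... | e , e∈E , inc , e≢e₀ with incident⇒joins e inc
    ... | u , w₀eu with any? (u Fin.≟_) rest
    ... | yes u∈rest = chord⇒cycle simple path u∈rest u~w₀
      where u~w₀ = joins-adj (edge-at e∈E) (joins-sym w₀eu)
    ... | no u∉rest =
      walk fuel u w₀ (w₁ ∷ rest) bound′ e∈E (joins-sym w₀eu) (fresh ∷ simple) (u~w₀ ∷ path)
      where
      u~w₀ = joins-adj (edge-at e∈E) (joins-sym w₀eu)
      bound′ : n < length (u ∷ w₀ ∷ w₁ ∷ rest) + fuel
      bound′ = subst (n <_) (ℕ.+-suc (length (w₀ ∷ w₁ ∷ rest)) fuel) bound
      u≢w₁ : u ≢ w₁
      u≢w₁ refl = e≢e₀ (joins-unique (proj₁ (edge-at e∈E)) (proj₁ (edge-at e₀∈E)) w₀eu w₀e₀w₁)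
      fresh : All (u ≢_) (w₀ ∷ w₁ ∷ rest)
      fresh = adj⇒≢ u~w₀ ∷ u≢w₁ ∷ ¬Any⇒All¬ rest u∉rest

    evenEdgeSet⇒cycle : ∃ (IsCycle G)
    evenEdgeSet⇒cycle with nonempty⇒member nonempty
    ... | (i , j) , e∈E with edge-at e∈E
    ... | j<i , i~j = walk n i j [] (ℕ.m<n⇒m<1+n (ℕ.n<1+n n)) e∈E (inj₁ refl)
                        ((ordered⇒distinct j<i ∷ []) ∷ [] ∷ []) (i~j ∷ [-])

  orient-edge : ∀ {a b} → Adj G a b → IsEdge (orient a b)
  orient-edge {a} {b} a~b with toℕ b ℕ.<? toℕ a
  ... | yes b<a = b<a , a~b
  ... | no b≮a = ℕ.≤∧≢⇒< (ℕ.≮⇒≥ b≮a) (λ eq → adj⇒≢ a~b (toℕ-injective eq)) , SimpleGraph.sym G a~b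

  walk-edges : ∀ {p} → Linked (Adj G) p → All IsEdge (walkEdges p)
  walk-edges [] = []
  walk-edges [-] = []
  walk-edges (a~b ∷ path) = orient-edge a~b ∷ walk-edges path

  cycle⇒evenEdgeSet : ∃ (IsCycle G) → EvenEdgeSet
  cycle⇒evenEdgeSet (_ , s≤s () , _ , v , [] , refl , _)
  cycle⇒evenEdgeSet (_ , s≤s (s≤s ()) , _ , v , _ ∷ [] , refl , _)
  cycle⇒evenEdgeSet (_ , _ , simple , v , w₁ ∷ w₂ ∷ r , refl , closed) = record
    { edges    = walkEdges (v ∷ w₁ ∷ w₂ ∷ r ++ [ v ])
    ; nonempty = λ ()
    ; areEdges = walk-edges closed
    ; distinct = cycle-edges-distinct simple
    ; even     = λ w → trans (walk-parity w v (w₁ ∷ w₂ ∷ r) v) (xor-same (does (w Fin.≟ v)))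
    }

  acyclic⇔noEvenEdgeSet : Acyclic G ⇔ (¬ EvenEdgeSet)
  acyclic⇔noEvenEdgeSet = mk⇔ (λ acyclic S → acyclic (evenEdgeSet⇒cycle S))
                               (λ none cycle → none (cycle⇒evenEdgeSet cycle))

relabel : ∀ {n} → SimpleGraph n → Labeling n → SimpleGraph n
relabel G σ = record
  { Adj    = λ i j → Adj G (Inverse.to σ i) (Inverse.to σ j)
  ; sym    = SimpleGraph.sym G
  ; irrefl = irrefl G
  }

relabel-acyclic : ∀ {n} (G : SimpleGraph n) σ → Acyclic G → Acyclic (relabel G σ)
relabel-acyclic G σ acyclic (vs , long , simple , v , ws , refl , closed) = acyclic
  ( map to vs
  , subst (3 ≤_) (sym (length-map to vs)) long
  , Unique.map⁺ (Injection.injective (↔⇒↣ σ)) simple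
  , to v , map to ws , refl
  , subst (Linked (Adj G)) (cong (to v ∷_) (map-++ to ws [ v ])) (Linked.map⁺ closed) )
  where to = Inverse.to σ

module _ {n : ℕ} (G : SimpleGraph n) (σ : Labeling n) where

  private
    H = relabel G σ

  encode : ∀ {E} → All (IsEdge H) E → All (β G σ) (map code E)
  encode [] = []
  encode {(i , j) ∷ _} ((j<i , i~j) ∷ es) = (i , j , j<i , i~j , refl) ∷ encode es

  decode : ∀ {xs} → All (β G σ) xs → ∃[ E ] (All (IsEdge H) E × map code E ≡ xs)
  decode [] = [] , [] , refl
  decode ((i , j , j<i , i~j , refl) ∷ bs) with decode bs
  ... | E , es , refl = (i , j) ∷ E , (j<i , i~j) ∷ es , refl

  independent⇔noEvenEdgeSet : LinIndep (β G σ) ⇔ (¬ EvenEdgeSet H)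
  independent⇔noEvenEdgeSet = mk⇔ to from
    where
    to : LinIndep (β G σ) → ¬ EvenEdgeSet H
    to independent S = nonempty (map-≡[] (independent (map code edges)
      (codes-distinct ordered distinct) (encode areEdges)
      (Equivalence.from (sum-codes-zero⇔even ordered) even)))
      where
      open EvenEdgeSet S
      ordered = All.map proj₁ areEdges
      map-≡[] : ∀ {E : List (Edge n)} → map code E ≡ [] → E ≡ []
      map-≡[] {[]} _ = refl

    from : ¬ EvenEdgeSet H → LinIndep (β G σ)
    from none _ distinct bs sum≡0 with decode bs
    ... | [] , _ , refl = refl
    ... | E@(_ ∷ _) , es , refl = ⊥-elim (none record
      { edges    = E
      ; nonempty = λ ()
      ; areEdges = es
      ; distinct = Unique.map⁻ distinct
      ; even     = Equivalence.to (sum-codes-zero⇔even (All.map proj₁ es)) sum≡0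
      })

-- The theorem.  (⇒) relabelling preserves acyclicity, so no relabelled graph has an
-- even edge set.  (⇐) for the identity labeling the relabelled graph is G itself.
corollary2 : (n : ℕ) (G : SimpleGraph n) →
    Acyclic G ⇔ ((σ : Labeling n) → LinIndep (β G σ))
corollary2 n G = mk⇔
  (λ acyclic σ → Equivalence.from (independent⇔noEvenEdgeSet G σ)
     (Equivalence.to (acyclic⇔noEvenEdgeSet (relabel G σ)) (relabel-acyclic G σ acyclic)))
  (λ independent → Equivalence.from (acyclic⇔noEvenEdgeSet G)
     (Equivalence.to (independent⇔noEvenEdgeSet G (↔-id (Fin n))) (independent (↔-id (Fin n)))))
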